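{- Let $T$ be a decomposition tree and $v$ an internal node of $T$ labeled $\oplus$, with left child $v_l$ and right child $v_r$, such that both $v_l$ and $v_r$ have the staircase property. If $\hat\alpha(v_r)>\hat\beta(v_l)$, then $\hat\beta(v)=0$.
   Context: All graphs are finite, simple and undirected. For a graph $H$ and $S\subseteq V(H)$, $N_H[S]$ is the closed neighbourhood of $S$ in $H$ and $H[S]$ the induced subgraph; a graph with no vertices is regarded as having a (empty) perfect matching. A decomposition tree is a rooted tree $T$ in which every internal node has exactly two children, a left child $v_l$ and a right child $v_r$, and carries one of the labels $\otimes$ (true twin), $\odot$ (false twin), $\oplus$ (attachment). To each node $v$ are associated a graph $\hat G(v)$ and a twin set $\hat{TS}(v)\subseteq V(\hat G(v))$: for a leaf, $\hat G(v)$ is a single vertex $x$ (distinct leaves giving distinct vertices) and $\hat{TS}(v)=\{x\}$; for an internal node $v$, $V(\hat G(v))=V(\hat G(v_l))\cup V(\hat G(v_r))$ and: if $v$ is labeled $\otimes$, $E(\hat G(v))=E(\hat G(v_l))\cup E(\hat G(v_r))\cup\{xy: x\in \hat{TS}(v_l), y\in\hat{TS}(v_r)\}$ and $\hat{TS}(v)=\hat{TS}(v_l)\cup\hat{TS}(v_r)$; if labeled $\odot$, $E(\hat G(v))=E(\hat G(v_l))\cup E(\hat G(v_r))$ and $\hat{TS}(v)=\hat{TS}(v_l)\cup\hat{TS}(v_r)$; if labeled $\oplus$, the edge set is as for $\otimes$ and $\hat{TS}(v)=\hat{TS}(v_l)$. For a node $u$ and $0\le k\le|\hat{TS}(u)|$,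 $\hat\gamma_k(u)$ is the minimum of $|S|$ over all $S\subseteq V(\hat G(u))$ with $V(\hat G(u))\setminus \hat{TS}(u)\subseteq N_{\hat G(u)}[S]$ for which there is $X\subseteq S\cap\hat{TS}(u)$, $|X|=k$, such that $\hat G(u)[S\setminus X]$ has a perfect matching. Let $\widehat{\min}(u)=\min\{\hat\gamma_k(u):0\le k\le|\hat{TS}(u)|\}$, and let $\hat\alpha(u)$ (resp. $\hat\beta(u)$) be the smallest (resp. largest) $k$ with $\hat\gamma_k(u)=\widehat{\min}(u)$. A node $u$ has the staircase property if for every $0\le k\le|\hat{TS}(u)|$: $\hat\gamma_k(u)=\widehat{\min}(u)+\hat\alpha(u)-k$ if $k\le\hat\alpha(u)$; $\hat\gamma_k(u)=\widehat{\min}(u)+k-\hat\beta(u)$ if $k\ge\hat\beta(u)$; $\hat\gamma_k(u)=\widehat{\min}(u)$ if $\hat\alpha(u)<k<\hat\beta(u)$ and $k-\hat\alpha(u)$ is even; and $\hat\gamma_k(u)=\widehat{\min}(u)+1$ otherwise. -}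

module Defs where

open import Data.Nat using (ℕ; zero; suc; _+_; _∸_; _≤_; _<_)
open import Data.Nat.Divisibility using (_∣_)
open import Data.Bool using (Bool; true; false; _∧_; not; T; if_then_else_)
open import Data.List using (List; []; _∷_; map; _++_)
open import Data.Product using (Σ; ∃; _×_; _,_)
open import Data.Sum using (_⊎_)
open import Data.Empty using (⊥)
open import Relation.Nullary using (¬_)
open import Relation.Binary.PropositionalEquality using (_≡_)

-- Node labels: ⊗ (true twin), ⊙ (false twin), ⊕ (attachment)
data Label : Set where
  ⊗ ⊙ ⊕ : Label

data Tree : Set where
  leaf : Tree
  node : Label → Tree → Tree → Tree

-- Vertices of Ĝ(v): the leaves of the subtree rooted at v (distinct leaves
-- give distinct vertices).
data Leaf : Tree → Set where
  here  : Leaf leaf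
  left  : ∀ {lab l r} → Leaf l → Leaf (node lab l r)
  right : ∀ {lab l r} → Leaf r → Leaf (node lab l r)

leaves : (t : Tree) → List (Leaf t)
leaves leaf = here ∷ []
leaves (node lab l r) = map left (leaves l) ++ map right (leaves r)

ts : (t : Tree) → Leaf t → Bool
ts leaf here = true
ts (node ⊗ l r) (left x) = ts l x
ts (node ⊗ l r) (right y) = ts r y
ts (node ⊙ l r) (left x) = ts l x
ts (node ⊙ l r) (right y) = ts r y
ts (node ⊕ l r) (left x) = ts l x
ts (node ⊕ l r) (right y) = false

joins : Label → Bool
joins ⊗ = true
joins ⊙ = false
joins ⊕ = true

Adj : (t : Tree) → Leaf t → Leaf t → Set
Adj leaf here here = ⊥
Adj (node lab l r) (left x) (left y) = Adj l x y
Adj (node lab l r) (right x) (right y) = Adj r x y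
Adj (node lab l r) (left x) (right y) = T (joins lab ∧ (ts l x ∧ ts r y))
Adj (node lab l r) (right x) (left y) = T (joins lab ∧ (ts l y ∧ ts r x))

Subset : Tree → Set
Subset t = Leaf t → Bool

countL : ∀ {A : Set} → List A → (A → Bool) → ℕ
countL [] P = 0
countL (a ∷ as) P = (if P a then 1 else 0) + countL as P

∣_∣ : ∀ {t} → Subset t → ℕ
∣_∣ {t} S = countL (leaves t) S

-- Ĝ(t)[W] has a perfect matching: a fixed-point-free involution on W
-- pairing each vertex of W with an adjacent vertex of W.
HasPM : (t : Tree) → Subset t → Set
HasPM t W = Σ (Leaf t → Leaf t) λ p →
  ∀ x → W x ≡ true →
    (W (p x) ≡ true) × (¬ (p x ≡ x)) × Adj t x (p x) × (p (p x) ≡ x)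

Dominates : (t : Tree) → Subset t → Set
Dominates t S = ∀ y → ts t y ≡ false →
  Σ (Leaf t) λ x → (S x ≡ true) × ((x ≡ y) ⊎ Adj t x y)

Feasible : (t : Tree) → ℕ → Subset t → Set
Feasible t k S = Dominates t S ×
  Σ (Subset t) λ X →
    (∀ x → X x ≡ true → (S x ≡ true) × (ts t x ≡ true)) ×
    (∣ X ∣ ≡ k) ×
    HasPM t (λ x → S x ∧ not (X x))

-- γ̂_k(t) = g  (g a natural number; γ̂_k(t) = ∞ when nothing is feasible,
-- in which case IsGammaHat t k g holds for no g)
IsGammaHat : (t : Tree) → ℕ → ℕ → Set
IsGammaHat t k g =
  (Σ (Subset t) λ S → Feasible t k S × (∣ S ∣ ≡ g)) ×
  (∀ S → Feasible t k S → g ≤ ∣ S ∣)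

IsMinHat : Tree → ℕ → Set
IsMinHat t m = (∃ λ k → IsGammaHat t k m) × (∀ k g → IsGammaHat t k g → m ≤ g)

IsAlphaHat : Tree → ℕ → Set
IsAlphaHat t a = Σ ℕ λ m → IsMinHat t m × IsGammaHat t a m ×
  (∀ k → k < a → ¬ IsGammaHat t k m)

IsBetaHat : Tree → ℕ → Set
IsBetaHat t b = Σ ℕ λ m → IsMinHat t m × IsGammaHat t b m ×
  (∀ k → b < k → ¬ IsGammaHat t k m)

Staircase : Tree → Set
Staircase t = Σ ℕ λ m → Σ ℕ λ a → Σ ℕ λ b →
  IsMinHat t m × IsAlphaHat t a × IsBetaHat t b ×
  (∀ k → k ≤ ∣ ts t ∣ →
     (k ≤ a → IsGammaHat t k (m + (a ∸ k))) ×
     (b ≤ k → IsGammaHat t k (m + (k ∸ b))) ×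
     (a < k → k < b → 2 ∣ (k ∸ a) → IsGammaHat t k m) ×
     (a < k → k < b → ¬ (2 ∣ (k ∸ a)) → IsGammaHat t k (suc m)))

-- At an attachment node v the twin set is T̂S(v_l), and every matching edge of Ĝ(v) between
-- the two sides joins a twin of v_l to a twin of v_r.  Cutting a set S admissible for γ̂_k(v)
-- along the two sides and moving the j endpoints of crossing matching edges on each side into
-- the unmatched sets X gives sets admissible for γ̂_(k+j)(v_l) and γ̂_j(v_r).  Conversely, for
-- j ≥ 1, sets admissible for γ̂_j(v_l) and γ̂_j(v_r) glue, matching their X-sets across, to one
-- admissible for γ̂_0(v) (the twins of v_l also dominate those of v_r).  So γ̂_0(v) is
-- μ = min_(j ≥ 1) γ̂_j(v_l) + γ̂_j(v_r); the value j = 0 does no better since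
-- γ̂_0(v_r) = γ̂_1(v_r) + 1 and γ̂_1(v_l) ≤ γ̂_0(v_l) + 1.  For k ≥ 1 the bound
-- γ̂_(k+j)(v_l) + γ̂_j(v_r) exceeds μ: if k + j ≤ α̂(v_r) it beats the term j' = k + j, as γ̂ of
-- v_r strictly decreases up to α̂(v_r); otherwise k + j > α̂(v_r) > β̂(v_l) and it beats the
-- term j' = α̂(v_r), as γ̂ of v_l strictly increases from β̂(v_l) on and γ̂_j(v_r) ≥ min̂(v_r).

module Submission where

open import Defs
open import Data.Nat using (_<_)
open import Data.Nat using (ℕ; zero; suc; _+_; _∸_; _≤_; _⊓_; z≤n; s≤s; _≤?_)
open import Data.Nat.Properties
open import Data.Nat.Divisibility using (_∣_; _∣?_)
open import Data.Bool using (Bool; true; false; _∧_; _∨_; not; T; if_then_else_)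
open import Data.Bool.Properties using (not-injective; ∧-identityʳ)
open import Data.List using ([]; _∷_; map; _++_; upTo)
open import Data.List.Extrema.Nat using (argmin; f[argmin]≤f[xs]; argmin-all)
open import Data.List.Relation.Unary.All.Properties using (applyUpTo⁻; all-upTo)
open import Data.Product using (∃; _×_; _,_; proj₁; proj₂)
open import Data.Sum using (_⊎_; inj₁; inj₂; [_,_]′)
open import Data.Unit using (tt)
open import Data.Empty using (⊥-elim)
open import Function using (id; _∘_)
open import Relation.Nullary using (¬_; yes; no)
open import Relation.Binary.PropositionalEquality

∧-true : ∀ {a b} → a ∧ b ≡ true → a ≡ true × b ≡ true
∧-true {true} b≡true = refl , b≡true

∧-intro : ∀ {a b} → a ≡ true → b ≡ true → a ∧ b ≡ true
∧-intro refl refl = refl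

∨-true : ∀ {a b} → a ∨ b ≡ true → a ≡ true ⊎ b ≡ true
∨-true {true}  _      = inj₁ refl
∨-true {false} b≡true = inj₂ b≡true

T-∧ : ∀ {a b} → T (a ∧ b) → a ≡ true × b ≡ true
T-∧ {true} {true} _ = refl , refl

false≢true : ¬ false ≡ true
false≢true ()

if-true : ∀ {A : Set} {b} {x y : A} → b ≡ true → (if b then x else y) ≡ x
if-true refl = refl

if-false : ∀ {A : Set} {b} {x y : A} → b ≡ false → (if b then x else y) ≡ y
if-false refl = refl

module _ {A : Set} where

  countL-cong : ∀ xs {P Q : A → Bool} → (∀ x → P x ≡ Q x) → countL xs P ≡ countL xs Q
  countL-cong []       P≗Q = refl
  countL-cong (x ∷ xs) P≗Q rewrite P≗Q x = cong (_ +_) (countL-cong xs P≗Q)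

  countL-++ : ∀ xs ys (P : A → Bool) → countL (xs ++ ys) P ≡ countL xs P + countL ys P
  countL-++ []       ys P = refl
  countL-++ (x ∷ xs) ys P =
    trans (cong (_ +_) (countL-++ xs ys P)) (sym (+-assoc (if P x then 1 else 0) _ _))

  countL-map : ∀ {B : Set} (f : B → A) xs (P : A → Bool) → countL (map f xs) P ≡ countL xs (λ x → P (f x))
  countL-map f []       P = refl
  countL-map f (x ∷ xs) P = cong (_ +_) (countL-map f xs P)

  countL-none : ∀ xs {P : A → Bool} → (∀ x → P x ≡ false) → countL xs P ≡ 0
  countL-none []       P≡false = refl
  countL-none (x ∷ xs) P≡false rewrite P≡false x = countL-none xs P≡false

  countL-mono : ∀ xs {P Q : A → Bool} → (∀ x → P x ≡ true → Q x ≡ true) → countL xs P ≤ countL xs Q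
  countL-mono []       P⊆Q = z≤n
  countL-mono (x ∷ xs) {P} {Q} P⊆Q with P x in Px
  ... | true rewrite P⊆Q x Px = s≤s (countL-mono xs P⊆Q)
  ... | false = ≤-trans (countL-mono xs P⊆Q) (m≤n+m _ (if Q x then 1 else 0))

  countL-∨ : ∀ xs {P Q : A → Bool} → (∀ x → P x ∧ Q x ≡ false) →
             countL xs (λ x → P x ∨ Q x) ≡ countL xs P + countL xs Q
  countL-∨ []       disjoint = refl
  countL-∨ (x ∷ xs) {P} {Q} disjoint with P x in Px | Q x in Qx
  ... | true  | true  = ⊥-elim (false≢true (trans (sym (disjoint x)) (cong₂ _∧_ Px Qx)))
  ... | true  | false = cong suc (countL-∨ xs disjoint)
  ... | false | true  = trans (cong suc (countL-∨ xs disjoint)) (sym (+-suc _ _))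
  ... | false | false = countL-∨ xs disjoint

  countL-witness : ∀ xs {P : A → Bool} {n} → countL xs P ≡ suc n → ∃ λ x → P x ≡ true
  countL-witness (x ∷ xs) {P} count≡suc with P x in Px
  ... | true  = x , Px
  ... | false = countL-witness xs count≡suc

∅ : ∀ {t} → Subset t
∅ _ = false

_∪_ _∖_ : ∀ {t} → Subset t → Subset t → Subset t
(A ∪ B) x = A x ∨ B x
(A ∖ B) x = A x ∧ not (B x)

∖-∖ : ∀ {t} (S X C : Subset t) x → ((S ∖ X) ∖ C) x ≡ (S ∖ (X ∪ C)) x
∖-∖ S X C x with S x | X x
... | false | _     = refl
... | true  | true  = refl
... | true  | false = refl

_⊎ˢ_ : ∀ {lab l r} → Subset l → Subset r → Subset (node lab l r)
(A ⊎ˢ B) (left x)  = A x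
(A ⊎ˢ B) (right y) = B y

_==_ : ∀ {t} → Leaf t → Leaf t → Bool
here    == here    = true
left x  == left y  = x == y
right x == right y = x == y
left _  == right _ = false
right _ == left _  = false

==-refl : ∀ {t} (x : Leaf t) → (x == x) ≡ true
==-refl here      = refl
==-refl (left x)  = ==-refl x
==-refl (right x) = ==-refl x

==⇒≡ : ∀ {t} {x y : Leaf t} → (x == y) ≡ true → x ≡ y
==⇒≡ {x = here}    {here}    _ = refl
==⇒≡ {x = left x}  {left y}  e = cong left (==⇒≡ e)
==⇒≡ {x = right x} {right y} e = cong right (==⇒≡ e)

｛_｝ : ∀ {t} → Leaf t → Subset t
｛ a ｝ x = x == a

∣∣-node : ∀ {lab l r} (P : Subset (node lab l r)) →
          ∣ P ∣ ≡ ∣ (λ x → P (left x)) ∣ + ∣ (λ y → P (right y)) ∣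
∣∣-node {l = l} {r} P =
  trans (countL-++ (map left (leaves l)) (map right (leaves r)) P)
        (cong₂ _+_ (countL-map left (leaves l) P) (countL-map right (leaves r) P))

∣⊎ˢ∣ : ∀ {lab l r} (A : Subset l) (B : Subset r) → ∣ _⊎ˢ_ {lab} A B ∣ ≡ ∣ A ∣ + ∣ B ∣
∣⊎ˢ∣ A B = ∣∣-node (A ⊎ˢ B)

∣∅∣ : ∀ {t} → ∣ ∅ {t} ∣ ≡ 0
∣∅∣ {t} = countL-none (leaves t) (λ _ → refl)

∣｛｝∣ : ∀ {t} (a : Leaf t) → ∣ ｛ a ｝ ∣ ≡ 1
∣｛｝∣ here      = refl
∣｛｝∣ {node lab l r} (left x)  = trans (∣∣-node ｛ left x ｝) (cong₂ _+_ (∣｛｝∣ x) (∣∅∣ {r}))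
∣｛｝∣ {node lab l r} (right y) = trans (∣∣-node {l = l} ｛ right y ｝) (cong₂ _+_ (∣∅∣ {l}) (∣｛｝∣ y))

≢⇒==false : ∀ {t} {x a : Leaf t} → ¬ x ≡ a → (x == a) ≡ false
≢⇒==false {x = x} {a} x≢a with x == a in e
... | true  = ⊥-elim (x≢a (==⇒≡ e))
... | false = refl

∈-∖｛｝ : ∀ {t} (A : Subset t) {a x} → A x ≡ true → ¬ x ≡ a → (A ∖ ｛ a ｝) x ≡ true
∈-∖｛｝ A Ax x≢a = ∧-intro Ax (cong not (≢⇒==false x≢a))

∈-∖｛｝⁻ : ∀ {t} (A : Subset t) {a x} → (A ∖ ｛ a ｝) x ≡ true → A x ≡ true × ¬ x ≡ a
∈-∖｛｝⁻ A {a} x∈ with ∧-true x∈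
... | Ax , x≠a = Ax , λ { refl → false≢true (trans (sym (cong not (==-refl a))) x≠a) }

∣∣-remove : ∀ {t} (P : Subset t) {a} → P a ≡ true → ∣ P ∣ ≡ suc ∣ P ∖ ｛ a ｝ ∣
∣∣-remove {t} P {a} Pa = begin
  ∣ P ∣                        ≡⟨ countL-cong (leaves t) P≗ ⟩
  ∣ (P ∖ ｛ a ｝) ∪ ｛ a ｝ ∣     ≡⟨ countL-∨ (leaves t) (λ x → disjoint (P x) (x == a)) ⟩
  ∣ P ∖ ｛ a ｝ ∣ + ∣ ｛ a ｝ ∣    ≡⟨ cong (∣ P ∖ ｛ a ｝ ∣ +_) (∣｛｝∣ a) ⟩
  ∣ P ∖ ｛ a ｝ ∣ + 1           ≡⟨ +-comm _ 1 ⟩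
  suc ∣ P ∖ ｛ a ｝ ∣           ∎
  where
  open ≡-Reasoning
  split : ∀ p e → (e ≡ true → p ≡ true) → p ≡ (p ∧ not e) ∨ e
  split true  true  _ = refl
  split true  false _ = refl
  split false true  h = h refl
  split false false _ = refl
  disjoint : ∀ p e → (p ∧ not e) ∧ e ≡ false
  disjoint true  true  = refl
  disjoint true  false = refl
  disjoint false _     = refl
  P≗ : ∀ x → P x ≡ ((P ∖ ｛ a ｝) ∪ ｛ a ｝) x
  P≗ x = split (P x) (x == a) (λ x=a → subst (λ z → P z ≡ true) (sym (==⇒≡ x=a)) Pa)

∣∣-witness : ∀ {t} (P : Subset t) {n} → ∣ P ∣ ≡ suc n → ∃ λ x → P x ≡ true
∣∣-witness {t} P = countL-witness (leaves t)

∣∣-mono : ∀ {t} {P Q : Subset t} → (∀ x → P x ≡ true → Q x ≡ true) → ∣ P ∣ ≤ ∣ Q ∣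
∣∣-mono {t} = countL-mono (leaves t)

someLeaf : ∀ t → Leaf t
someLeaf leaf         = here
someLeaf (node _ l _) = left (someLeaf l)

record Bijection {t u} (A : Subset t) (B : Subset u) : Set where
  field
    to      : Leaf t → Leaf u
    from    : Leaf u → Leaf t
    to-∈    : ∀ x → A x ≡ true → B (to x) ≡ true
    from-∈  : ∀ y → B y ≡ true → A (from y) ≡ true
    from∘to : ∀ x → A x ≡ true → from (to x) ≡ x
    to∘from : ∀ y → B y ≡ true → to (from y) ≡ y

Bijection-sym : ∀ {t u} {A : Subset t} {B : Subset u} → Bijection A B → Bijection B A
Bijection-sym f = record
  { to = from ; from = to ; to-∈ = from-∈ ; from-∈ = to-∈ ; from∘to = to∘from ; to∘from = from∘to }
  where open Bijection f

Bijection-remove : ∀ {t u} {A : Subset t} {B : Subset u} (f : Bijection A B) {a} → A a ≡ true →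
                   Bijection (A ∖ ｛ a ｝) (B ∖ ｛ Bijection.to f a ｝)
Bijection-remove {A = A} {B} f {a} Aa = record
  { to = to ; from = from
  ; to-∈ = λ x x∈ → let Ax , x≢a = ∈-∖｛｝⁻ A x∈ in
      ∈-∖｛｝ B (to-∈ x Ax) λ tx≡ta → x≢a (trans (sym (from∘to x Ax)) (trans (cong from tx≡ta) (from∘to a Aa)))
  ; from-∈ = λ y y∈ → let By , y≢ta = ∈-∖｛｝⁻ B y∈ in
      ∈-∖｛｝ A (from-∈ y By) λ fy≡a → y≢ta (trans (sym (to∘from y By)) (cong to fy≡a))
  ; from∘to = λ x x∈ → from∘to x (proj₁ (∈-∖｛｝⁻ A x∈))
  ; to∘from = λ y y∈ → to∘from y (proj₁ (∈-∖｛｝⁻ B y∈))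
  }
  where open Bijection f

Bijection-extend : ∀ {t u} {A : Subset t} {B : Subset u} {a b} → A a ≡ true → B b ≡ true →
                   Bijection (A ∖ ｛ a ｝) (B ∖ ｛ b ｝) → Bijection A B
Bijection-extend {t} {u} {A} {B} {a} {b} Aa Bb f = record
  { to = to ; from = from ; to-∈ = to-∈ ; from-∈ = from-∈ ; from∘to = from∘to ; to∘from = to∘from }
  where
  module f = Bijection f
  to : Leaf t → Leaf u
  to x = if x == a then b else f.to x
  from : Leaf u → Leaf t
  from y = if y == b then a else f.from y

  to-∈ : ∀ x → A x ≡ true → B (to x) ≡ true
  to-∈ x Ax with x == a in x=a
  ... | true  = Bb
  ... | false = proj₁ (∧-true (f.to-∈ x (∧-intro Ax (cong not x=a))))
  from-∈ : ∀ y → B y ≡ true → A (from y) ≡ true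
  from-∈ y By with y == b in y=b
  ... | true  = Aa
  ... | false = proj₁ (∧-true (f.from-∈ y (∧-intro By (cong not y=b))))
  from∘to : ∀ x → A x ≡ true → from (to x) ≡ x
  from∘to x Ax with x == a in x=a
  ... | true  rewrite ==-refl b = sym (==⇒≡ x=a)
  ... | false = let x∈ = ∧-intro Ax (cong not x=a) in
    trans (if-false {b = f.to x == b} (not-injective (proj₂ (∧-true (f.to-∈ x x∈))))) (f.from∘to x x∈)
  to∘from : ∀ y → B y ≡ true → to (from y) ≡ y
  to∘from y By with y == b in y=b
  ... | true  rewrite ==-refl a = sym (==⇒≡ y=b)
  ... | false = let y∈ = ∧-intro By (cong not y=b) in
    trans (if-false {b = f.from y == a} (not-injective (proj₂ (∧-true (f.from-∈ y y∈))))) (f.to∘from y y∈)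

Bijection⇒∣∣≤ : ∀ {t u} {A : Subset t} {B : Subset u} → Bijection A B → ∣ A ∣ ≤ ∣ B ∣
Bijection⇒∣∣≤ f = go _ refl f
  where
  go : ∀ {t u} {A : Subset t} {B : Subset u} n → ∣ A ∣ ≡ n → Bijection A B → ∣ A ∣ ≤ ∣ B ∣
  go zero    ∣A∣≡0 f = ≤-trans (≤-reflexive ∣A∣≡0) z≤n
  go {A = A} {B} (suc n) ∣A∣≡n f with a , Aa ← ∣∣-witness A ∣A∣≡n = begin
    ∣ A ∣                            ≡⟨ ∣∣-remove A Aa ⟩
    suc ∣ A ∖ ｛ a ｝ ∣               ≤⟨ s≤s (go n (suc-injective (trans (sym (∣∣-remove A Aa)) ∣A∣≡n)) (Bijection-remove f Aa)) ⟩
    suc ∣ B ∖ ｛ Bijection.to f a ｝ ∣ ≡⟨ sym (∣∣-remove B (Bijection.to-∈ f a Aa)) ⟩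
    ∣ B ∣                            ∎
    where open ≤-Reasoning

Bijection⇒∣∣≡ : ∀ {t u} {A : Subset t} {B : Subset u} → Bijection A B → ∣ A ∣ ≡ ∣ B ∣
Bijection⇒∣∣≡ f = ≤-antisym (Bijection⇒∣∣≤ f) (Bijection⇒∣∣≤ (Bijection-sym f))

∣∣≡⇒Bijection : ∀ {t u} {A : Subset t} {B : Subset u} → ∣ A ∣ ≡ ∣ B ∣ → Bijection A B
∣∣≡⇒Bijection ∣A∣≡∣B∣ = go _ ∣A∣≡∣B∣ refl
  where
  go : ∀ {t u} {A : Subset t} {B : Subset u} n → ∣ A ∣ ≡ n → ∣ B ∣ ≡ n → Bijection A B
  go {t} {u} {A} {B} zero ∣A∣≡0 ∣B∣≡0 = record
    { to = λ _ → someLeaf u ; from = λ _ → someLeaf t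
    ; to-∈ = λ x Ax → ⊥-elim (empty A ∣A∣≡0 Ax) ; from-∈ = λ y By → ⊥-elim (empty B ∣B∣≡0 By)
    ; from∘to = λ x Ax → ⊥-elim (empty A ∣A∣≡0 Ax) ; to∘from = λ y By → ⊥-elim (empty B ∣B∣≡0 By) }
    where
    empty : ∀ {t} (P : Subset t) {x} → ∣ P ∣ ≡ 0 → ¬ P x ≡ true
    empty P ∣P∣≡0 Px = 0≢1+n (trans (sym ∣P∣≡0) (∣∣-remove P Px))
  go {A = A} {B} (suc n) ∣A∣≡n ∣B∣≡n
    with a , Aa ← ∣∣-witness A ∣A∣≡n | b , Bb ← ∣∣-witness B ∣B∣≡n =
    Bijection-extend Aa Bb (go n (suc-injective (trans (sym (∣∣-remove A Aa)) ∣A∣≡n))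
                                 (suc-injective (trans (sym (∣∣-remove B Bb)) ∣B∣≡n)))

IsPerfectMatching : (t : Tree) → Subset t → (Leaf t → Leaf t) → Set
IsPerfectMatching t W p = ∀ x → W x ≡ true →
  (W (p x) ≡ true) × (¬ (p x ≡ x)) × Adj t x (p x) × (p (p x) ≡ x)

IsPerfectMatching-cong : ∀ {t} {W W′ : Subset t} {p} → (∀ x → W x ≡ W′ x) →
                         IsPerfectMatching t W p → IsPerfectMatching t W′ p
IsPerfectMatching-cong W≗W′ pm x W′x with pm x (trans (W≗W′ x) W′x)
... | Wpx , px≢x , adj , ppx = trans (sym (W≗W′ _)) Wpx , px≢x , adj , ppx

module _ {lab : Label} {l r : Tree} where

  isLeft isRight : Leaf (node lab l r) → Bool
  isLeft (left _)  = true
  isLeft (right _) = false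
  isRight (left _)  = false
  isRight (right _) = true

  leftOr : Leaf l → Leaf (node lab l r) → Leaf l
  leftOr _ (left x)  = x
  leftOr d (right _) = d

  rightOr : Leaf r → Leaf (node lab l r) → Leaf r
  rightOr d (left _)  = d
  rightOr _ (right y) = y

module Restrict {lab l r} {W : Subset (node lab l r)} {p}
                (pm : IsPerfectMatching (node lab l r) W p) where

  crossingˡ : Subset l
  crossingˡ x = W (left x) ∧ isRight (p (left x))

  crossingʳ : Subset r
  crossingʳ y = W (right y) ∧ isLeft (p (right y))

  pˡ : Leaf l → Leaf l
  pˡ x = leftOr x (p (left x))

  pʳ : Leaf r → Leaf r
  pʳ y = rightOr y (p (right y))

  private
    ∧-not : ∀ {a c} → a ≡ true → not (a ∧ c) ≡ true → c ≡ false
    ∧-not refl = not-injective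

  restrictˡ : IsPerfectMatching l ((λ x → W (left x)) ∖ crossingˡ) pˡ
  restrictˡ x x∈ with Wx , uncrossed ← ∧-true x∈
    with p (left x) | pm (left x) Wx | ∧-not {c = isRight (p (left x))} Wx uncrossed
  ... | left x′ | Wx′ , x′≢x , adj , ppx | _ =
    ∧-intro Wx′ (cong not (cong₂ _∧_ Wx′ (cong isRight ppx))) , (λ e → x′≢x (cong left e)) ,
    adj , cong (leftOr x′) ppx

  restrictʳ : IsPerfectMatching r ((λ y → W (right y)) ∖ crossingʳ) pʳ
  restrictʳ y y∈ with Wy , uncrossed ← ∧-true y∈
    with p (right y) | pm (right y) Wy | ∧-not {c = isLeft (p (right y))} Wy uncrossed
  ... | right y′ | Wy′ , y′≢y , adj , ppy | _ =
    ∧-intro Wy′ (cong not (cong₂ _∧_ Wy′ (cong isLeft ppy))) , (λ e → y′≢y (cong right e)) ,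
    adj , cong (rightOr y′) ppy

  -- The default someLeaf is junk: only the values on crossing vertices matter.
  partnerˡ : Leaf l → Leaf r
  partnerˡ x = rightOr (someLeaf r) (p (left x))

  partnerʳ : Leaf r → Leaf l
  partnerʳ y = leftOr (someLeaf l) (p (right y))

  crossing-bijection : Bijection crossingˡ crossingʳ
  crossing-bijection = record
    { to = partnerˡ ; from = partnerʳ
    ; to-∈ = to-∈ ; from-∈ = from-∈ ; from∘to = from∘to ; to∘from = to∘from }
    where
    to-∈ : ∀ x → crossingˡ x ≡ true → crossingʳ (partnerˡ x) ≡ true
    to-∈ x x∈ with Wx , crossed ← ∧-true x∈ with p (left x) | pm (left x) Wx | crossed
    ... | right _ | Wpx , _ , _ , ppx | _ = ∧-intro Wpx (cong isLeft ppx)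
    from-∈ : ∀ y → crossingʳ y ≡ true → crossingˡ (partnerʳ y) ≡ true
    from-∈ y y∈ with Wy , crossed ← ∧-true y∈ with p (right y) | pm (right y) Wy | crossed
    ... | left _ | Wpy , _ , _ , ppy | _ = ∧-intro Wpy (cong isRight ppy)
    from∘to : ∀ x → crossingˡ x ≡ true → partnerʳ (partnerˡ x) ≡ x
    from∘to x x∈ with Wx , crossed ← ∧-true x∈ with p (left x) | pm (left x) Wx | crossed
    ... | right _ | _ , _ , _ , ppx | _ = cong (leftOr (someLeaf l)) ppx
    to∘from : ∀ y → crossingʳ y ≡ true → partnerˡ (partnerʳ y) ≡ y
    to∘from y y∈ with Wy , crossed ← ∧-true y∈ with p (right y) | pm (right y) Wy | crossed
    ... | left _ | _ , _ , _ , ppy | _ = cong (rightOr (someLeaf r)) ppy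

⊕-edge : ∀ {l r x y} → ts l x ≡ true → ts r y ≡ true → Adj (node ⊕ l r) (left x) (right y)
⊕-edge tsx tsy = subst T (sym (cong₂ _∧_ tsx tsy)) tt

⊕-crossingˡ⇒ts : ∀ {l r} x (z : Leaf (node ⊕ l r)) → Adj (node ⊕ l r) (left x) z → isRight z ≡ true → ts l x ≡ true
⊕-crossingˡ⇒ts x (right _) adj _ = proj₁ (T-∧ adj)

⊕-crossingʳ⇒ts : ∀ {l r} y (z : Leaf (node ⊕ l r)) → Adj (node ⊕ l r) (right y) z → isLeft z ≡ true → ts r y ≡ true
⊕-crossingʳ⇒ts {l} y (left x) adj _ = proj₂ (T-∧ {ts l x} adj)

⊕-dominates⁻ : ∀ {l r} {S : Subset (node ⊕ l r)} → Dominates (node ⊕ l r) S →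
               Dominates l (λ x → S (left x)) × Dominates r (λ y → S (right y))
⊕-dominates⁻ {l} {r} {S} dom = domˡ , domʳ
  where
  domˡ : Dominates l (λ x → S (left x))
  domˡ y tsy with dom (left y) tsy
  ... | left x , Sx , inj₁ refl = x , Sx , inj₁ refl
  ... | left x , Sx , inj₂ adj  = x , Sx , inj₂ adj
  ... | right _ , _ , inj₂ adj  = ⊥-elim (false≢true (trans (sym tsy) (proj₁ (T-∧ adj))))
  domʳ : Dominates r (λ y → S (right y))
  domʳ y tsy with dom (right y) refl
  ... | right x , Sx , inj₁ refl = x , Sx , inj₁ refl
  ... | right x , Sx , inj₂ adj  = x , Sx , inj₂ adj
  ... | left x , _ , inj₂ adj    = ⊥-elim (false≢true (trans (sym tsy) (proj₂ (T-∧ {ts l x} adj))))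

⊕-dominates⁺ : ∀ {l r} {Sˡ : Subset l} {Sʳ : Subset r} → Dominates l Sˡ → Dominates r Sʳ →
               (∃ λ x → Sˡ x ≡ true × ts l x ≡ true) → Dominates (node ⊕ l r) (Sˡ ⊎ˢ Sʳ)
⊕-dominates⁺ domˡ domʳ _ (left y) tsy with domˡ y tsy
... | x , Sx , inj₁ refl = left x , Sx , inj₁ refl
... | x , Sx , inj₂ adj  = left x , Sx , inj₂ adj
⊕-dominates⁺ {l} {r} domˡ domʳ (x , Sx , tsx) (right y) _ with ts r y in tsy
... | true  = left x , Sx , inj₂ (⊕-edge {l} {r} tsx tsy)
... | false with domʳ y tsy
...   | y′ , Sy′ , inj₁ refl = right y′ , Sy′ , inj₁ refl
...   | y′ , Sy′ , inj₂ adj  = right y′ , Sy′ , inj₂ adj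

⊕-split : ∀ {l r k S} → Feasible (node ⊕ l r) k S →
          ∃ λ j → Feasible l (k + j) (λ x → S (left x)) × Feasible r j (λ y → S (right y))
⊕-split {l} {r} {k} {S} (dom , X , X⊆ , ∣X∣≡k , p , pm) =
  ∣ crossingʳ ∣ , (domˡ , Xˡ , Xˡ⊆ , ∣Xˡ∣ , pˡ , pmˡ) , (domʳ , Xʳ , Xʳ⊆ , ∣Xʳ∣ , pʳ , pmʳ)
  where
  open Restrict pm

  domˡ : Dominates l (λ x → S (left x))
  domˡ = proj₁ (⊕-dominates⁻ dom)

  domʳ : Dominates r (λ y → S (right y))
  domʳ = proj₂ (⊕-dominates⁻ dom)

  Xˡ : Subset l
  Xˡ = (λ x → X (left x)) ∪ crossingˡ

  Xʳ : Subset r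
  Xʳ = (λ y → X (right y)) ∪ crossingʳ

  pmˡ : IsPerfectMatching l ((λ x → S (left x)) ∖ Xˡ) pˡ
  pmˡ = IsPerfectMatching-cong (∖-∖ (λ x → S (left x)) (λ x → X (left x)) crossingˡ) restrictˡ

  pmʳ : IsPerfectMatching r ((λ y → S (right y)) ∖ Xʳ) pʳ
  pmʳ = IsPerfectMatching-cong (∖-∖ (λ y → S (right y)) (λ y → X (right y)) crossingʳ) restrictʳ

  X-right : ∀ y → X (right y) ≡ false
  X-right y with X (right y) in Xy
  ... | true  = ⊥-elim (false≢true (proj₂ (X⊆ (right y) Xy)))
  ... | false = refl

  disjoint : ∀ a s c → a ∧ ((s ∧ not a) ∧ c) ≡ false
  disjoint false _     _ = refl
  disjoint true  false _ = refl
  disjoint true  true  _ = refl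

  ∣X∘left∣≡k : ∣ (λ x → X (left x)) ∣ ≡ k
  ∣X∘left∣≡k = begin
    ∣ (λ x → X (left x)) ∣                            ≡⟨ +-identityʳ _ ⟨
    ∣ (λ x → X (left x)) ∣ + 0                        ≡⟨ cong (∣ (λ x → X (left x)) ∣ +_) (countL-none (leaves r) X-right) ⟨
    ∣ (λ x → X (left x)) ∣ + ∣ (λ y → X (right y)) ∣ ≡⟨ ∣∣-node X ⟨
    ∣ X ∣                                             ≡⟨ ∣X∣≡k ⟩
    k                                                 ∎
    where open ≡-Reasoning

  ∣Xˡ∣ : ∣ Xˡ ∣ ≡ k + ∣ crossingʳ ∣
  ∣Xˡ∣ = trans (countL-∨ (leaves l) (λ x → disjoint (X (left x)) (S (left x)) _))
               (cong₂ _+_ ∣X∘left∣≡k (Bijection⇒∣∣≡ crossing-bijection))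

  ∣Xʳ∣ : ∣ Xʳ ∣ ≡ ∣ crossingʳ ∣
  ∣Xʳ∣ = trans (countL-∨ (leaves r) (λ y → disjoint (X (right y)) (S (right y)) _))
               (cong (_+ ∣ crossingʳ ∣) (countL-none (leaves r) X-right))

  Xˡ⊆ : ∀ x → Xˡ x ≡ true → S (left x) ≡ true × ts l x ≡ true
  Xˡ⊆ x x∈ with ∨-true x∈
  ... | inj₁ Xx = X⊆ (left x) Xx
  ... | inj₂ crossed with Wx , toRight ← ∧-true crossed =
    proj₁ (∧-true Wx) , ⊕-crossingˡ⇒ts x (p (left x)) (proj₁ (proj₂ (proj₂ (pm (left x) Wx)))) toRight

  Xʳ⊆ : ∀ y → Xʳ y ≡ true → S (right y) ≡ true × ts r y ≡ true
  Xʳ⊆ y y∈ with ∨-true y∈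
  ... | inj₁ Xy = ⊥-elim (false≢true (proj₂ (X⊆ (right y) Xy)))
  ... | inj₂ crossed with Wy , toLeft ← ∧-true crossed =
    proj₁ (∧-true Wy) , ⊕-crossingʳ⇒ts y (p (right y)) (proj₁ (proj₂ (proj₂ (pm (right y) Wy)))) toLeft

module Glue {l r} {Sˡ Xˡ : Subset l} {Sʳ Xʳ : Subset r} {pˡ pʳ}
  (Xˡ⊆ : ∀ x → Xˡ x ≡ true → Sˡ x ≡ true × ts l x ≡ true)
  (Xʳ⊆ : ∀ y → Xʳ y ≡ true → Sʳ y ≡ true × ts r y ≡ true)
  (pmˡ : IsPerfectMatching l (Sˡ ∖ Xˡ) pˡ) (pmʳ : IsPerfectMatching r (Sʳ ∖ Xʳ) pʳ)
  (f : Bijection Xˡ Xʳ) where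

  open Bijection f

  glue : Leaf (node ⊕ l r) → Leaf (node ⊕ l r)
  glue (left x)  = if Xˡ x then right (to x) else left (pˡ x)
  glue (right y) = if Xʳ y then left (from y) else right (pʳ y)

  glue-isPerfectMatching : IsPerfectMatching (node ⊕ l r) (Sˡ ⊎ˢ Sʳ) glue
  glue-isPerfectMatching (left x) Sx with Xˡ x in Xx
  ... | true  = let Xto = to-∈ x Xx in
    proj₁ (Xʳ⊆ _ Xto) , (λ ()) , ⊕-edge {l} {r} (proj₂ (Xˡ⊆ x Xx)) (proj₂ (Xʳ⊆ _ Xto)) ,
    trans (if-true Xto) (cong left (from∘to x Xx))
  ... | false with Sp , px≢x , adj , ppx ← pmˡ x (∧-intro Sx (cong not Xx)) =
    proj₁ (∧-true Sp) , (λ e → px≢x (cong (leftOr (pˡ x)) e)) , adj ,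
    trans (if-false {b = Xˡ (pˡ x)} (not-injective (proj₂ (∧-true Sp)))) (cong left ppx)
  glue-isPerfectMatching (right y) Sy with Xʳ y in Xy
  ... | true  = let Xfrom = from-∈ y Xy in
    proj₁ (Xˡ⊆ _ Xfrom) , (λ ()) , ⊕-edge {l} {r} (proj₂ (Xˡ⊆ _ Xfrom)) (proj₂ (Xʳ⊆ y Xy)) ,
    trans (if-true Xfrom) (cong right (to∘from y Xy))
  ... | false with Sp , py≢y , adj , ppy ← pmʳ y (∧-intro Sy (cong not Xy)) =
    proj₁ (∧-true Sp) , (λ e → py≢y (cong (rightOr (pʳ y)) e)) , adj ,
    trans (if-false {b = Xʳ (pʳ y)} (not-injective (proj₂ (∧-true Sp)))) (cong right ppy)

⊕-join : ∀ {l r j} {Sˡ : Subset l} {Sʳ : Subset r} → Feasible l (suc j) Sˡ → Feasible r (suc j) Sʳ →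
         Feasible (node ⊕ l r) 0 (Sˡ ⊎ˢ Sʳ)
⊕-join {l} {r} (domˡ , Xˡ , Xˡ⊆ , ∣Xˡ∣ , pˡ , pmˡ) (domʳ , Xʳ , Xʳ⊆ , ∣Xʳ∣ , pʳ , pmʳ) =
  ⊕-dominates⁺ domˡ domʳ twin , ∅ , (λ _ ()) , ∣∅∣ {node ⊕ l r} , glue ,
  IsPerfectMatching-cong (λ z → sym (∧-identityʳ _)) glue-isPerfectMatching
  where
  open Glue Xˡ⊆ Xʳ⊆ pmˡ pmʳ (∣∣≡⇒Bijection (trans ∣Xˡ∣ (sym ∣Xʳ∣)))
  twin : ∃ λ x → _ ≡ true × ts l x ≡ true
  twin = let x , Xx = ∣∣-witness Xˡ ∣Xˡ∣ in x , Xˡ⊆ x Xx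

Feasible⇒≤∣ts∣ : ∀ {t k S} → Feasible t k S → k ≤ ∣ ts t ∣
Feasible⇒≤∣ts∣ {t} (_ , X , X⊆ , ∣X∣≡k , _) = subst (_≤ ∣ ts t ∣) ∣X∣≡k (∣∣-mono (λ x Xx → proj₂ (X⊆ x Xx)))

γ̂⇒≤∣ts∣ : ∀ {t k g} → IsGammaHat t k g → k ≤ ∣ ts t ∣
γ̂⇒≤∣ts∣ ((_ , S-feasible , _) , _) = Feasible⇒≤∣ts∣ S-feasible

γ̂-unique : ∀ {t k g g′} → IsGammaHat t k g → IsGammaHat t k g′ → g ≡ g′
γ̂-unique ((S , S-feasible , ∣S∣≡g) , g-min) ((S′ , S′-feasible , ∣S′∣≡g′) , g′-min) =
  ≤-antisym (subst (_ ≤_) ∣S′∣≡g′ (g-min S′ S′-feasible)) (subst (_ ≤_) ∣S∣≡g (g′-min S S-feasible))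

ts-someLeaf : ∀ t → ts t (someLeaf t) ≡ true
ts-someLeaf leaf         = refl
ts-someLeaf (node ⊗ l _) = ts-someLeaf l
ts-someLeaf (node ⊙ l _) = ts-someLeaf l
ts-someLeaf (node ⊕ l _) = ts-someLeaf l

∣ts∣>0 : ∀ t → 0 < ∣ ts t ∣
∣ts∣>0 t = ≤-trans (s≤s z≤n) (≤-reflexive (sym (∣∣-remove (ts t) (ts-someLeaf t))))

stair : ℕ → ℕ → ℕ → ℕ → ℕ
stair m a b k with k ≤? a | b ≤? k | 2 ∣? (k ∸ a)
... | yes _ | _     | _     = m + (a ∸ k)
... | no _  | yes _ | _     = m + (k ∸ b)
... | no _  | no _  | yes _ = m
... | no _  | no _  | no _  = suc m

StaircaseProfile : Tree → ℕ → ℕ → ℕ → Set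
StaircaseProfile t m a b = ∀ k → k ≤ ∣ ts t ∣ →
  (k ≤ a → IsGammaHat t k (m + (a ∸ k))) ×
  (b ≤ k → IsGammaHat t k (m + (k ∸ b))) ×
  (a < k → k < b → 2 ∣ (k ∸ a) → IsGammaHat t k m) ×
  (a < k → k < b → ¬ (2 ∣ (k ∸ a)) → IsGammaHat t k (suc m))

StaircaseProfile⇒γ̂ : ∀ {t m a b} → StaircaseProfile t m a b →
                     ∀ k → k ≤ ∣ ts t ∣ → IsGammaHat t k (stair m a b k)
StaircaseProfile⇒γ̂ {a = a} {b} prof k k≤N with k ≤? a | b ≤? k | 2 ∣? (k ∸ a) | prof k k≤N
... | yes k≤a | _       | _       | descent , _ = descent k≤a
... | no _    | yes b≤k | _       | _ , ascent , _ = ascent b≤k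
... | no k≰a  | no k≱b  | yes even | _ , _ , plateau , _ = plateau (≰⇒> k≰a) (≰⇒> k≱b) even
... | no k≰a  | no k≱b  | no odd  | _ , _ , _ , step = step (≰⇒> k≰a) (≰⇒> k≱b) odd

StaircaseProfile-≥β : ∀ {t m a b k} → StaircaseProfile t m a b → b ≤ k → k ≤ ∣ ts t ∣ →
                      stair m a b k ≡ m + (k ∸ b)
StaircaseProfile-≥β {k = k} prof b≤k k≤N =
  γ̂-unique (StaircaseProfile⇒γ̂ prof k k≤N) (proj₁ (proj₂ (prof k k≤N)) b≤k)

stair-≤α : ∀ {m a b k} → k ≤ a → stair m a b k ≡ m + (a ∸ k)
stair-≤α {a = a} {k = k} k≤a with k ≤? a
... | yes _   = refl
... | no k≰a  = ⊥-elim (k≰a k≤a)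

stair-decreasing : ∀ {m a b j k} → j < k → k ≤ a → stair m a b k < stair m a b j
stair-decreasing {m} {a} {b} {j} {k} j<k k≤a = begin-strict
  stair m a b k ≡⟨ stair-≤α k≤a ⟩
  m + (a ∸ k)   <⟨ +-monoʳ-< m (∸-monoʳ-< j<k k≤a) ⟩
  m + (a ∸ j)   ≡⟨ stair-≤α (<⇒≤ (<-≤-trans j<k k≤a)) ⟨
  stair m a b j ∎
  where open ≤-Reasoning

m≤stair : ∀ m a b k → m ≤ stair m a b k
m≤stair m a b k with k ≤? a | b ≤? k | 2 ∣? (k ∸ a)
... | yes _ | _     | _     = m≤m+n m _
... | no _  | yes _ | _     = m≤m+n m _
... | no _  | no _  | yes _ = ≤-refl
... | no _  | no _  | no _  = n≤1+n m

stair-1≤ : ∀ m a b → stair m a b 1 ≤ suc (stair m a b 0)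
stair-1≤ m a b rewrite stair-≤α {m} {a} {b} (z≤n {a}) with 1 ≤? a | b ≤? 1 | 2 ∣? (1 ∸ a)
... | yes _ | _     | _     = ≤-trans (+-monoʳ-≤ m (m∸n≤m a 1)) (n≤1+n _)
... | no _  | yes _ | _     = ≤-trans (+-monoʳ-≤ m (m∸n≤m 1 b)) (≤-trans (≤-reflexive (+-comm m 1)) (s≤s (m≤m+n m a)))
... | no _  | no _  | yes _ = ≤-trans (m≤m+n m a) (n≤1+n _)
... | no _  | no _  | no _  = s≤s (m≤m+n m a)

module _ {l r : Tree} {mˡ aˡ bˡ mʳ aʳ bʳ : ℕ}
         (profˡ : StaircaseProfile l mˡ aˡ bˡ) (profʳ : StaircaseProfile r mʳ aʳ bʳ)
         (aʳ≤Nʳ : aʳ ≤ ∣ ts r ∣) (bˡ<aʳ : bˡ < aʳ) where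

  private
    v : Tree
    v = node ⊕ l r

    Nˡ Nʳ : ℕ
    Nˡ = ∣ ts l ∣
    Nʳ = ∣ ts r ∣

    F G H : ℕ → ℕ
    F = stair mˡ aˡ bˡ
    G = stair mʳ aʳ bʳ
    H j = F j + G j

    split-lower-bound : ∀ {k S} → Feasible v k S → ∃ λ j → k + j ≤ Nˡ × j ≤ Nʳ × F (k + j) + G j ≤ ∣ S ∣
    split-lower-bound {k} {S} S-feasible with j , Sˡ-feasible , Sʳ-feasible ← ⊕-split S-feasible =
      j , k+j≤Nˡ , j≤Nʳ ,
      subst (F (k + j) + G j ≤_) (sym (∣∣-node S))
        (+-mono-≤ (proj₂ (StaircaseProfile⇒γ̂ profˡ (k + j) k+j≤Nˡ) _ Sˡ-feasible)
                  (proj₂ (StaircaseProfile⇒γ̂ profʳ j j≤Nʳ) _ Sʳ-feasible))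
      where
      k+j≤Nˡ : k + j ≤ Nˡ
      k+j≤Nˡ = Feasible⇒≤∣ts∣ Sˡ-feasible
      j≤Nʳ : j ≤ Nʳ
      j≤Nʳ = Feasible⇒≤∣ts∣ Sʳ-feasible

    M : ℕ
    M = Nˡ ⊓ Nʳ

    -- suc i* minimises H over 1 ≤ j ≤ M.
    i* : ℕ
    i* = argmin (H ∘ suc) 0 (upTo M)

    μ : ℕ
    μ = H (suc i*)

    μ-min : ∀ j → 0 < j → j ≤ Nˡ → j ≤ Nʳ → μ ≤ H j
    μ-min (suc i) _ i<Nˡ i<Nʳ = applyUpTo⁻ id M (f[argmin]≤f[xs] 0 (upTo M)) (⊓-glb i<Nˡ i<Nʳ)

    μ-attained : ∃ λ S → Feasible v 0 S × ∣ S ∣ ≡ μ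
    μ-attained =
      let ((Sˡ , Sˡ-feasible , ∣Sˡ∣) , _) = StaircaseProfile⇒γ̂ profˡ (suc i*) (≤-trans i*<M (m⊓n≤m Nˡ Nʳ))
          ((Sʳ , Sʳ-feasible , ∣Sʳ∣) , _) = StaircaseProfile⇒γ̂ profʳ (suc i*) (≤-trans i*<M (m⊓n≤n Nˡ Nʳ))
      in Sˡ ⊎ˢ Sʳ , ⊕-join Sˡ-feasible Sʳ-feasible , trans (∣⊎ˢ∣ Sˡ Sʳ) (cong₂ _+_ ∣Sˡ∣ ∣Sʳ∣)
      where
      i*<M : i* < M
      i*<M = argmin-all (H ∘ suc) {P = _< M} (⊓-glb (∣ts∣>0 l) (∣ts∣>0 r)) (all-upTo M)

    H1≤H0 : H 1 ≤ H 0
    H1≤H0 = begin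
      F 1 + G 1       ≤⟨ +-monoˡ-≤ (G 1) (stair-1≤ mˡ aˡ bˡ) ⟩
      suc (F 0) + G 1 ≡⟨ +-suc (F 0) (G 1) ⟨
      F 0 + suc (G 1) ≤⟨ +-monoʳ-≤ (F 0) (stair-decreasing {mʳ} {aʳ} {bʳ} (s≤s z≤n) (<-≤-trans (s≤s z≤n) bˡ<aʳ)) ⟩
      F 0 + G 0       ∎
      where open ≤-Reasoning

    μ≤H : ∀ j → j ≤ Nˡ → j ≤ Nʳ → μ ≤ H j
    μ≤H zero    _ _ = ≤-trans (μ-min 1 (s≤s z≤n) (∣ts∣>0 l) (∣ts∣>0 r)) H1≤H0
    μ≤H (suc j) = μ-min (suc j) (s≤s z≤n)

    μ<F+G : ∀ k j → 0 < k → k + j ≤ Nˡ → j ≤ Nʳ → μ < F (k + j) + G j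
    μ<F+G k j 0<k i≤Nˡ j≤Nʳ = [ descent , ascent ]′ (≤-<-connex (k + j) aʳ)
      where
      open ≤-Reasoning
      descent : k + j ≤ aʳ → μ < F (k + j) + G j
      descent i≤aʳ = begin-strict
        μ                     ≤⟨ μ-min (k + j) (≤-trans 0<k (m≤m+n k j)) i≤Nˡ (≤-trans i≤aʳ aʳ≤Nʳ) ⟩
        F (k + j) + G (k + j) <⟨ +-monoʳ-< (F (k + j)) (stair-decreasing {mʳ} {aʳ} {bʳ} j<k+j i≤aʳ) ⟩
        F (k + j) + G j       ∎
        where
        j<k+j : j < k + j
        j<k+j = <-≤-trans (n<1+n j) (+-monoˡ-≤ j 0<k)
      ascent : aʳ < k + j → μ < F (k + j) + G j
      ascent aʳ<i = begin-strict
        μ                  ≤⟨ μ-min aʳ (<-≤-trans (s≤s z≤n) bˡ<aʳ) (≤-trans (<⇒≤ aʳ<i) i≤Nˡ) aʳ≤Nʳ ⟩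
        F aʳ + G aʳ        ≡⟨ cong (F aʳ +_) G-aʳ≡mʳ ⟩
        F aʳ + mʳ          <⟨ +-mono-<-≤ F-increasing (m≤stair mʳ aʳ bʳ j) ⟩
        F (k + j) + G j    ∎
        where
        G-aʳ≡mʳ : G aʳ ≡ mʳ
        G-aʳ≡mʳ = trans (stair-≤α {mʳ} {aʳ} {bʳ} ≤-refl) (trans (cong (mʳ +_) (n∸n≡0 aʳ)) (+-identityʳ mʳ))
        F-increasing : F aʳ < F (k + j)
        F-increasing = begin-strict
          F aʳ               ≡⟨ StaircaseProfile-≥β {k = aʳ} profˡ (<⇒≤ bˡ<aʳ) (≤-trans (<⇒≤ aʳ<i) i≤Nˡ) ⟩
          mˡ + (aʳ ∸ bˡ)     <⟨ +-monoʳ-< mˡ (∸-monoˡ-< aʳ<i (<⇒≤ bˡ<aʳ)) ⟩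
          mˡ + (k + j ∸ bˡ)  ≡⟨ StaircaseProfile-≥β {k = k + j} profˡ (≤-trans (<⇒≤ bˡ<aʳ) (<⇒≤ aʳ<i)) i≤Nˡ ⟨
          F (k + j)          ∎

    μ≤∣S∣ : ∀ {k S} → Feasible v k S → μ ≤ ∣ S ∣
    μ<∣S∣ : ∀ {k S} → 0 < k → Feasible v k S → μ < ∣ S ∣

    μ≤∣S∣ {zero} S-feasible =
      let j , j≤Nˡ , j≤Nʳ , H≤∣S∣ = split-lower-bound S-feasible in ≤-trans (μ≤H j j≤Nˡ j≤Nʳ) H≤∣S∣
    μ≤∣S∣ {suc k} S-feasible = <⇒≤ (μ<∣S∣ (s≤s z≤n) S-feasible)

    μ<∣S∣ {k} 0<k S-feasible =
      let j , i≤Nˡ , j≤Nʳ , F+G≤∣S∣ = split-lower-bound S-feasible in <-≤-trans (μ<F+G k j 0<k i≤Nˡ j≤Nʳ) F+G≤∣S∣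

    γ̂₀ : IsGammaHat v 0 μ
    γ̂₀ = μ-attained , λ _ → μ≤∣S∣

  ⊕-β̂≡0 : IsBetaHat (node ⊕ l r) 0
  ⊕-β̂≡0 = μ , ((0 , γ̂₀) , μ≤γ̂) , γ̂₀ , γ̂≢μ
    where
    μ≤γ̂ : ∀ k g → IsGammaHat v k g → μ ≤ g
    μ≤γ̂ _ _ ((S , S-feasible , ∣S∣≡g) , _) = subst (μ ≤_) ∣S∣≡g (μ≤∣S∣ S-feasible)
    γ̂≢μ : ∀ k → 0 < k → ¬ IsGammaHat v k μ
    γ̂≢μ _ 0<k ((S , S-feasible , ∣S∣≡μ) , _) = <-irrefl (sym ∣S∣≡μ) (μ<∣S∣ 0<k S-feasible)

lemma40 : (l r : Tree) → Staircase l → Staircase r →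
    (∀ a b → IsAlphaHat r a → IsBetaHat l b → b < a) →
    IsBetaHat (node ⊕ l r) 0
lemma40 l r (_ , _ , bˡ , _ , _ , β̂ˡ , profˡ) (_ , aʳ , _ , _ , α̂ʳ@(_ , _ , γ̂ʳ , _) , _ , profʳ) α̂ʳ>β̂ˡ =
  ⊕-β̂≡0 profˡ profʳ (γ̂⇒≤∣ts∣ γ̂ʳ) (α̂ʳ>β̂ˡ aʳ bˡ α̂ʳ β̂ˡ)
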